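{- Let $\mathbf{v}=(v_1,\dots,v_m)$ and $\mathbf{k}=(k_1,\dots,k_m)$ be $m$-tuples of positive integers with $\mathbf{v}\ge\mathbf{k}$, and let $t$ be an integer with $1\le t\le m$. Then \[ C(\mathbf{v},\mathbf{k},t)\ge \max_{i_1,\dots,i_t} \left\lceil \frac{v_{i_1}}{k_{i_1}}\left\lceil\frac{v_{i_2}}{k_{i_2}}\cdots\left\lceil\frac{v_{i_t}}{k_{i_t}}\right\rceil\cdots\right\rceil\right\rceil, \] where the maximum is over all choices of distinct indices $i_1,\dots,i_t\in\{1,\dots,m\}$.
   Context: $\mathbf{v}\ge\mathbf{k}$ means componentwise. Generalized covering designs: for $m$-tuples of positive integers $\mathbf{v}$, $\mathbf{k}$ with $k_i\le v_i$ and an integer $t$ with $1\le t\le \sum_i k_i$, let $X_1,\dots,X_m$ be pairwise disjoint sets with $|X_i|=v_i$. A block is an $m$-tuple $(B_1,\dots,B_m)$ with $B_i\subseteq X_i$, $|B_i|=k_i$. An $m$-tuple of sets $(T_1,\dots,T_m)$ is $(\mathbf{v},\mathbf{k},t)$-admissible if $T_i\subseteq X_i$, $|T_i|\le k_i$ and $\sum_i|T_i|=t$; it is contained in a block if $T_i\subseteq B_i$ for all $i$. A ${\rm GC}(\mathbf{v},\mathbf{k},t)$ is a family of blocks (repetitions allowed) such that every admissible tuple is contained in at least one block, and $C(\mathbf{v},\mathbf{k},t)$ is the minimum number of blocks of a ${\rm GC}(\mathbf{v},\mathbf{k},t)$. -}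

module Defs where

open import Data.Nat using (ℕ; zero; suc; _+_; _*_; _≤_; _/_)
open import Data.Fin using (Fin)
open import Data.Fin.Subset using (Subset; _⊆_; ∣_∣)
open import Data.List using (List)
open import Data.List.Relation.Unary.Any using (Any)
open import Data.Product using (_×_)
open import Data.Vec.Functional using (foldr)
open import Relation.Binary.PropositionalEquality using (_≡_)

-- Ground sets: X_i = Fin (v i); they are pairwise disjoint since they are
-- tagged by the coordinate i.

-- Ceiling division ⌈ a / b ⌉ for b ≥ 1 (the b = 0 clause is never used,
-- since all k_i ≥ 1).
⌈_/_⌉ : ℕ → ℕ → ℕ
⌈ a / zero ⌉ = 0
⌈ a / suc b ⌉ = (a + b) / suc b

∑ : ∀ {m} → (Fin m → ℕ) → ℕ
∑ f = foldr _+_ 0 f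

Tuple : ∀ {m} → (Fin m → ℕ) → Set
Tuple {m} v = (i : Fin m) → Subset (v i)

record Block {m : ℕ} (v k : Fin m → ℕ) : Set where
  constructor block
  field
    sets : Tuple v
    size : (i : Fin m) → ∣ sets i ∣ ≡ k i

open Block public

Admissible : ∀ {m} (v k : Fin m → ℕ) (t : ℕ) → Tuple v → Set
Admissible {m} v k t T = ((i : Fin m) → ∣ T i ∣ ≤ k i) × (∑ (λ i → ∣ T i ∣) ≡ t)

ContainedIn : ∀ {m} {v k : Fin m → ℕ} → Tuple v → Block v k → Set
ContainedIn {m} T B = (i : Fin m) → T i ⊆ sets B i

-- A GC(v,k,t): a list of blocks (repetitions allowed) such that every
-- admissible tuple is contained in at least one block.
IsGC : ∀ {m} (v k : Fin m → ℕ) (t : ℕ) → List (Block v k) → Set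
IsGC v k t F = (T : Tuple v) → Admissible v k t T → Any (ContainedIn T) F

-- Nested ceiling for an index sequence i_1,…,i_s:
--   ⌈ v_{i_1}/k_{i_1} ⌈ v_{i_2}/k_{i_2} ⋯ ⌈ v_{i_s}/k_{i_s} ⌉ ⋯ ⌉ ⌉
-- using ⌈ (v/k)·x ⌉ = ⌈ v·x / k ⌉ for natural x; the empty product is 1.
nestedCeil : ∀ {m} (v k : Fin m → ℕ) {s : ℕ} → (Fin s → Fin m) → ℕ
nestedCeil v k {s} idx = foldr (λ j acc → ⌈ v j * acc / k j ⌉) 1 idx

-- Fix distinct coordinates i₁, …, iₜ. A point chosen in each of X_{i₁}, …, X_{iₜ}
-- gives an admissible tuple of singletons, so a GC(v,k,t) contains every such
-- transversal in some block. For the bound, pick x ∈ X_{i₁}: the blocks with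
-- x ∈ B_{i₁} cover all transversals of the remaining coordinates, hence number
-- at least N = ⌈ v_{i₂}/k_{i₂} ⌈ ⋯ ⌉ ⌉ by induction. Each block contains k_{i₁}
-- points of X_{i₁}, so double counting gives v_{i₁} N ≤ k_{i₁} |F|.
module Submission where

open import Defs
open import Data.Nat using (ℕ; _≤_)
open import Data.Fin using (Fin)
open import Data.List using (List; length)
open import Function.Definitions using (Injective)
open import Relation.Binary.PropositionalEquality using (_≡_)

open import Data.Nat.Properties
open import Algebra.Properties.Semiring.Sum +-*-semiring
  using (sum-cong-≗; sum-replicate-zero; sum-remove; ∑-distrib-+; ∑-comm)
open import Data.Bool.Base using (if_then_else_)
open import Data.Empty using (⊥-elim)
open import Function using (_∘_)
open import Data.Fin using (zero; suc; punchIn) renaming (_≟_ to _≟ᶠ_)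
open import Data.Fin.Properties using (any?; punchInᵢ≢i)
open import Data.Fin.Subset using (Subset; inside; outside; ⁅_⁆; ⊥; _∈_; ∣_∣)
open import Data.Fin.Subset.Properties using (_∈?_; x∈⁅x⁆; ∣⁅x⁆∣≡1; ∣⊥∣≡0)
open import Data.List using ([]; _∷_; filter)
open import Data.List.Relation.Unary.Any as Any using (Any; here; there)
open import Data.List.Relation.Unary.Any.Properties using (filter⁺; lookup-result)
open import Data.Nat using (suc; _+_; _*_; _<_; z≤n; s≤s)
open import Data.Nat.DivMod using (m<n*o⇒m/o<n)
open import Data.Product using (∃; _,_)
open import Data.Sum using ([_,_]′)
open import Data.Vec using ([]; _∷_)
open import Relation.Binary.PropositionalEquality using (refl; sym; trans; cong; cong₂; subst; module ≡-Reasoning)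
open import Relation.Nullary using (Dec; yes; no; does; ¬_)
open import Relation.Unary using (Pred; Decidable)

𝟙 : ∀ {p} {P : Set p} → Dec P → ℕ
𝟙 P? = if does P? then 1 else 0

𝟙-yes : ∀ {p} {P : Set p} (P? : Dec P) → P → 𝟙 P? ≡ 1
𝟙-yes (yes _) _ = refl
𝟙-yes (no ¬p) p = ⊥-elim (¬p p)

𝟙-no : ∀ {p} {P : Set p} (P? : Dec P) → ¬ P → 𝟙 P? ≡ 0
𝟙-no (yes p) ¬p = ⊥-elim (¬p p)
𝟙-no (no _) _ = refl

𝟙≤1 : ∀ {p} {P : Set p} (P? : Dec P) → 𝟙 P? ≤ 1
𝟙≤1 (yes _) = ≤-refl
𝟙≤1 (no _) = z≤n

∑-const : ∀ n c → ∑ {n} (λ _ → c) ≡ n * c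
∑-const ℕ.zero c = refl
∑-const (suc n) c = cong (c +_) (∑-const n c)

∑-mono-≤ : ∀ {n} {f g : Fin n → ℕ} → (∀ i → f i ≤ g i) → ∑ f ≤ ∑ g
∑-mono-≤ {ℕ.zero} f≤g = z≤n
∑-mono-≤ {suc n} f≤g = +-mono-≤ (f≤g zero) (∑-mono-≤ (λ i → f≤g (suc i)))

∑-𝟙-none : ∀ {p n} {P : Pred (Fin n) p} (P? : Decidable P) →
            (∀ i → ¬ P i) → ∑ (λ i → 𝟙 (P? i)) ≡ 0
∑-𝟙-none {n = n} P? ¬P = trans (sum-cong-≗ (λ i → 𝟙-no (P? i) (¬P i))) (sum-replicate-zero n)

∑-𝟙-unique : ∀ {p n} {P : Pred (Fin n) p} (P? : Decidable P) {a : Fin n} →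
             P a → (∀ {i} → P i → i ≡ a) → ∑ (λ i → 𝟙 (P? i)) ≡ 1
∑-𝟙-unique {n = suc n} {P} P? {a} Pa unique = begin
  ∑ (λ i → 𝟙 (P? i))                                  ≡⟨ sum-remove {i = a} (λ i → 𝟙 (P? i)) ⟩
  𝟙 (P? a) + ∑ (λ j → 𝟙 (P? (punchIn a j)))           ≡⟨ cong₂ _+_ (𝟙-yes (P? a) Pa) (∑-𝟙-none (P? ∘ punchIn a) ¬P∘punchIn) ⟩
  1 + 0                                               ∎
  where
  open ≡-Reasoning
  ¬P∘punchIn : ∀ j → ¬ P (punchIn a j)
  ¬P∘punchIn j P[j] = punchInᵢ≢i a j (unique P[j])

∑-𝟙-∈ : ∀ {n} (S : Subset n) → ∑ (λ x → 𝟙 (x ∈? S)) ≡ ∣ S ∣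
∑-𝟙-∈ [] = refl
∑-𝟙-∈ (inside ∷ S) = cong suc (∑-𝟙-∈ S)
∑-𝟙-∈ (outside ∷ S) = ∑-𝟙-∈ S

image? : ∀ {t m} (f : Fin t → Fin m) → Decidable (λ i → ∃ λ s → f s ≡ i)
image? f i = any? (λ s → f s ≟ᶠ i)

∑-𝟙-image : ∀ {t m} {f : Fin t → Fin m} → Injective _≡_ _≡_ f →
            ∑ (λ i → 𝟙 (image? f i)) ≡ t
∑-𝟙-image {t} {f = f} f-inj = begin
  ∑ (λ i → 𝟙 (image? f i))                  ≡⟨ sum-cong-≗ 𝟙-image≡∑ ⟩
  ∑ (λ i → ∑ (λ s → 𝟙 (f s ≟ᶠ i)))          ≡⟨ ∑-comm (λ i s → 𝟙 (f s ≟ᶠ i)) ⟩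
  ∑ (λ s → ∑ (λ i → 𝟙 (f s ≟ᶠ i)))          ≡⟨ sum-cong-≗ (λ s → ∑-𝟙-unique (f s ≟ᶠ_) refl sym) ⟩
  ∑ {t} (λ _ → 1)                           ≡⟨ ∑-const t 1 ⟩
  t * 1                                     ≡⟨ *-identityʳ t ⟩
  t                                         ∎
  where
  open ≡-Reasoning
  𝟙-image≡∑ : ∀ i → 𝟙 (image? f i) ≡ ∑ (λ s → 𝟙 (f s ≟ᶠ i))
  𝟙-image≡∑ i with image? f i
  ... | yes (s , refl) = sym (∑-𝟙-unique (λ s′ → f s′ ≟ᶠ f s) refl f-inj)
  ... | no ∉image = sym (∑-𝟙-none (λ s → f s ≟ᶠ i) (λ s e → ∉image (s , e)))

length-filter-∷ : ∀ {a p} {A : Set a} {P : Pred A p} (P? : Decidable P) x xs →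
                  length (filter P? (x ∷ xs)) ≡ 𝟙 (P? x) + length (filter P? xs)
length-filter-∷ P? x xs with P? x
... | yes _ = refl
... | no _ = refl

∑-length-filter-∈ : ∀ {a} {A : Set a} {n c} (S : A → Subset n) → (∀ x → ∣ S x ∣ ≡ c) →
                    ∀ xs → ∑ (λ i → length (filter (λ x → i ∈? S x) xs)) ≡ c * length xs
∑-length-filter-∈ {n = n} {c} S ∣S∣≡c [] = trans (sum-replicate-zero n) (sym (*-zeroʳ c))
∑-length-filter-∈ {c = c} S ∣S∣≡c (x ∷ xs) = begin
  ∑ (λ i → length (filter (λ y → i ∈? S y) (x ∷ xs)))
    ≡⟨ sum-cong-≗ (λ i → length-filter-∷ (λ y → i ∈? S y) x xs) ⟩
  ∑ (λ i → 𝟙 (i ∈? S x) + length (filter (λ y → i ∈? S y) xs))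
    ≡⟨ ∑-distrib-+ (λ i → 𝟙 (i ∈? S x)) _ ⟩
  ∑ (λ i → 𝟙 (i ∈? S x)) + ∑ (λ i → length (filter (λ y → i ∈? S y) xs))
    ≡⟨ cong₂ _+_ (trans (∑-𝟙-∈ (S x)) (∣S∣≡c x)) (∑-length-filter-∈ S ∣S∣≡c xs) ⟩
  c + c * length xs
    ≡⟨ sym (*-suc c (length xs)) ⟩
  c * length (x ∷ xs)
    ∎
  where open ≡-Reasoning

⌈/⌉-≤ : ∀ a b L → 1 ≤ b → a ≤ b * L → ⌈ a / b ⌉ ≤ L
⌈/⌉-≤ a (suc b) L _ a≤ = ≤-pred (m<n*o⇒m/o<n a+b<[1+L]*[1+b])
  where
  open ≤-Reasoning
  a+b<[1+L]*[1+b] : a + b < suc L * suc b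
  a+b<[1+L]*[1+b] = begin-strict
    a + b               ≤⟨ +-monoˡ-≤ b a≤ ⟩
    suc b * L + b       <⟨ +-monoʳ-< (suc b * L) (n<1+n b) ⟩
    suc b * L + suc b   ≡⟨ +-comm (suc b * L) (suc b) ⟩
    suc b + suc b * L   ≡⟨ cong (suc b +_) (*-comm (suc b) L) ⟩
    suc L * suc b       ∎

CoversTransversals : ∀ {m} (v k : Fin m → ℕ) {t} → (Fin t → Fin m) → List (Block v k) → Set
CoversTransversals v k {t} idx F =
  (c : (s : Fin t) → Fin (v (idx s))) → Any (λ B → ∀ s → c s ∈ sets B (idx s)) F

coversTransversals-filter : ∀ {m} {v k : Fin m → ℕ} {t} (idx : Fin (suc t) → Fin m)
  {F : List (Block v k)} → CoversTransversals v k idx F → (x : Fin (v (idx zero))) →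
  CoversTransversals v k (idx ∘ suc) (filter (λ B → x ∈? sets B (idx zero)) F)
coversTransversals-filter {v = v} {t = t} idx cover x c =
  [ Any.map (λ x∷c⊆B s → x∷c⊆B (suc s)) , (λ x∉B → ⊥-elim (x∉B (lookup-result (cover x∷c) zero))) ]′
  (filter⁺ (λ B → x ∈? sets B (idx zero)) (cover x∷c))
  where
  x∷c : (s : Fin (suc t)) → Fin (v (idx s))
  x∷c zero = x
  x∷c (suc s) = c s

nestedCeil≤length : ∀ {m} (v k : Fin m → ℕ) → (∀ i → 1 ≤ k i) → ∀ {t} (idx : Fin t → Fin m)
  (F : List (Block v k)) → CoversTransversals v k idx F → nestedCeil v k idx ≤ length F
nestedCeil≤length v k k≥1 {ℕ.zero} idx F cover with cover (λ ())
... | here _ = s≤s z≤n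
... | there _ = s≤s z≤n
nestedCeil≤length {m} v k k≥1 {suc t} idx F cover =
  ⌈/⌉-≤ (v j * N) (k j) (length F) (k≥1 j) double-count
  where
  open ≤-Reasoning
  j : Fin m
  j = idx zero
  N : ℕ
  N = nestedCeil v k (idx ∘ suc)
  blocksThrough : Fin (v j) → List (Block v k)
  blocksThrough x = filter (λ B → x ∈? sets B j) F
  double-count : v j * N ≤ k j * length F
  double-count = begin
    v j * N                              ≡⟨ ∑-const (v j) N ⟨
    ∑ {v j} (λ _ → N)                    ≤⟨ ∑-mono-≤ (λ x → nestedCeil≤length v k k≥1 (idx ∘ suc) (blocksThrough x)
                                                             (coversTransversals-filter idx cover x)) ⟩
    ∑ (λ x → length (blocksThrough x))   ≡⟨ ∑-length-filter-∈ (λ B → sets B j) (λ B → size B j) F ⟩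
    k j * length F                       ∎

module _ {m : ℕ} (v : Fin m → ℕ) {t : ℕ} (idx : Fin t → Fin m) (c : (s : Fin t) → Fin (v (idx s))) where

  singletonTuple : Tuple v
  singletonTuple i with image? idx i
  ... | yes (s , e) = ⁅ subst (Fin ∘ v) e (c s) ⁆
  ... | no _ = ⊥

  ∣singletonTuple∣ : ∀ i → ∣ singletonTuple i ∣ ≡ 𝟙 (image? idx i)
  ∣singletonTuple∣ i with image? idx i
  ... | yes (s , e) = ∣⁅x⁆∣≡1 (subst (Fin ∘ v) e (c s))
  ... | no _ = ∣⊥∣≡0 (v i)

  ∈singletonTuple : Injective _≡_ _≡_ idx → ∀ s → c s ∈ singletonTuple (idx s)
  ∈singletonTuple idx-inj s with image? idx (idx s)
  ... | yes (s′ , e) = ∈⁅cast⁆ e (idx-inj e)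
    where
    ∈⁅cast⁆ : ∀ {s′} (e : idx s′ ≡ idx s) → s′ ≡ s → c s ∈ ⁅ subst (Fin ∘ v) e (c s′) ⁆
    ∈⁅cast⁆ refl refl = x∈⁅x⁆ (c s)
  ... | no ∉image = ⊥-elim (∉image (s , refl))

IsGC⇒CoversTransversals : ∀ {m} {v k : Fin m → ℕ} {t} {idx : Fin t → Fin m} {F : List (Block v k)} →
  (∀ i → 1 ≤ k i) → Injective _≡_ _≡_ idx → IsGC v k t F → CoversTransversals v k idx F
IsGC⇒CoversTransversals {v = v} {k} {t} {idx} k≥1 idx-inj gc c =
  Any.map (λ T⊆B s → T⊆B (idx s) (∈singletonTuple v idx c idx-inj s)) (gc T (fits , total))
  where
  T : Tuple v
  T = singletonTuple v idx c
  fits : ∀ i → ∣ T i ∣ ≤ k i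
  fits i = ≤-trans (≤-reflexive (∣singletonTuple∣ v idx c i)) (≤-trans (𝟙≤1 (image? idx i)) (k≥1 i))
  total : ∑ (λ i → ∣ T i ∣) ≡ t
  total = trans (sum-cong-≗ (∣singletonTuple∣ v idx c)) (∑-𝟙-image idx-inj)

corollary5p2 : (m : ℕ) (v k : Fin m → ℕ) (t : ℕ)
    → ((i : Fin m) → 1 ≤ k i) → ((i : Fin m) → k i ≤ v i)
    → 1 ≤ t → t ≤ m
    → (F : List (Block v k)) → IsGC v k t F
    → (idx : Fin t → Fin m) → Injective _≡_ _≡_ idx
    → nestedCeil v k idx ≤ length F
corollary5p2 m v k t k≥1 _ _ _ F gc idx idx-inj =
  nestedCeil≤length v k k≥1 idx F (IsGC⇒CoversTransversals k≥1 idx-inj gc)
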